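{- Let $h$ be any deterministic probe-sequence function mapping each key $x \in [U]$ to a sequence $(h_1(x), h_2(x), \ldots)$ with entries in $[N] \cup \{\mathrm{Null}\}$. Then there exists a nearly uniform probe-sequence function $h'$ (of the same type) such that for every assignment $A$ of $n$ keys to $N$ slots, $c(A, h') \le O(c(A, h) + n)$, where the constant in the $O(\cdot)$ is absolute.
   Context: For a probe-sequence function $h$, a key $x$ and a slot $s \in [N]$, the probe complexity of $x$ in slot $s$ is $\min\{k : h_k(x) = s\}$. For an assignment $A$ of $n$ distinct keys to $N$ slots (at most one key per slot), $c(A,h)$ denotes the sum over the $n$ keys of the probe complexity of each key in the slot $A$ assigns it to. For $i \ge 1$ and $s \in [N]$ let $q(h,i,s) = n \Pr_{x \in [U]}[\text{probe complexity of } x \text{ in } s \text{ under } h \text{ is} \le i]$, with $x$ uniform in $[U]$. A probe-sequence function $h$ is nearly uniform if there is an absolute constant $C$ with $q(h,i,s) \le C\, i^{10}$ for all $i \ge 1$ and $s \in [N]$. -}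

module Defs where

open import Data.Nat using (ℕ; zero; suc; _+_; _*_; _^_; _≤_; _<_)
open import Data.Fin using (Fin; zero; suc) renaming (_≟_ to _≟F_)
open import Data.Maybe using (Maybe; just; nothing)
open import Data.Bool using (Bool; true; false; _∨_; if_then_else_)
open import Data.List using (List; map; allFin)
open import Data.Nat.ListAction using () renaming (sum to lsum)
open import Data.Product using (Σ; _×_)
open import Relation.Nullary using (¬_; does)
open import Relation.Binary.PropositionalEquality using (_≡_)

-- A probe-sequence function for key universe [U] and slots [N]:
-- h x j  is the (j+1)-st probe  h_{j+1}(x)  (0-based storage of the
-- 1-based sequence h_1(x), h_2(x), ...); 'nothing' is Null.
ProbeFn : ℕ → ℕ → Set
ProbeFn U N = Fin U → ℕ → Maybe (Fin N)

ProbeCx : ∀ {N} → (ℕ → Maybe (Fin N)) → Fin N → ℕ → Set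
ProbeCx f s k =
  Σ ℕ λ m → (k ≡ suc m) × (f m ≡ just s) × (∀ j → j < m → ¬ (f j ≡ just s))

isHit : ∀ {N} → Maybe (Fin N) → Fin N → Bool
isHit nothing  s = false
isHit (just t) s = does (t ≟F s)

hitWithin : ∀ {N} → (ℕ → Maybe (Fin N)) → Fin N → ℕ → Bool
hitWithin f s zero    = false
hitWithin f s (suc i) = hitWithin f s i ∨ isHit (f i) s

countHits : ∀ {U N} → ProbeFn U N → Fin N → ℕ → ℕ
countHits {U} h s i =
  lsum (map (λ x → if hitWithin (h x) s i then 1 else 0) (allFin U))

-- q(h,i,s) = n * countHits h s i / U ; nearly uniform with constant C:
-- q(h,i,s) ≤ C i^10 for all i ≥ 1, s, i.e. (multiplying by U > 0)
NearlyUniform : ∀ {U N} → ℕ → ℕ → ProbeFn U N → Set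
NearlyUniform {U} {N} C n h =
  ∀ (i : ℕ) → 1 ≤ i → (s : Fin N) → n * countHits h s i ≤ C * (i ^ 10) * U

sumFin : ∀ {n} → (Fin n → ℕ) → ℕ
sumFin {zero}  f = 0
sumFin {suc n} f = f zero + sumFin (λ j → f (suc j))

-- The new probe sequence h′ moves the probe number o of h, when it goes to slot s, to
-- position 2^a + o, where a is the least level with o + 1 ≤ 2^a and n·q ≤ (2^a)^10·U, q
-- being the number of keys reaching s within o + 1 probes of h. Since o < 2^a, distinct
-- probes of a key never collide. A key reaching s within i probes of h′ therefore reached
-- it within some k ≤ i probes of h with n·q ≤ i^10·U; taking the largest such k gives
-- near-uniformity. A probe of complexity k lands at 2^a + k ≤ 3k unless the count
-- condition forced a larger level; then the excess e = 2^(a−1) ≥ k satisfies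
-- k³·U·e ≤ n·q. For fixed k the counts q sum to at most U·k over all slots, and an
-- assignment uses each slot once, so the excesses sum to at most n·∑ 2/(k(k+1)) ≤ 2n.

module Submission where

open import Defs
open import Data.Nat using (ℕ; zero; suc; _≟_; _+_; _*_; _^_; _≤_; _<_; z≤n; s≤s; _≤?_; NonZero; >-nonZero)
open import Data.Nat.Properties
open import Data.Nat.Tactic.RingSolver using (solve-∀)
open import Data.Fin using (Fin; zero; suc; toℕ; fromℕ<; punchOut) renaming (_≟_ to _≟F_)
open import Data.Fin.Properties using (toℕ-fromℕ<; punchIn-punchOut; punchOut-injective)
import Data.Fin.Properties as Finₚ
open import Data.Vec.Functional using (removeAt)
open import Data.Maybe as Maybe using (Maybe; just; nothing)
open import Data.Maybe.Properties using (just-injective; ≡-dec)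
open import Data.Bool using (Bool; true; false; _∨_; if_then_else_)
open import Data.Bool.Properties using (∨-zeroʳ)
open import Data.List using (map; allFin; tabulate)
open import Data.List.Properties using (map-tabulate)
open import Data.Nat.ListAction using () renaming (sum to lsum)
open import Data.Product using (Σ; _×_; _,_; proj₁; proj₂)
open import Data.Sum using (_⊎_; inj₁; inj₂; [_,_]′)
open import Function using (_∘_)
open import Function.Definitions using (Injective)
open import Relation.Nullary using (¬_; does; yes; no; contradiction)
open import Relation.Nullary.Decidable using (_×-dec_)
open import Relation.Unary using (Pred; Decidable)
open import Relation.Binary using (tri<; tri≈; tri>)
open import Relation.Binary.PropositionalEquality
open import Algebra.Properties.Semiring.Sum +-*-semiring
  using (sum; sum-syntax; sum-cong-≗; sum-replicate-zero; sum-remove; ∑-comm; ∑-distrib-+;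
         *-distribˡ-sum; *-distribʳ-sum)

𝟙 : Bool → ℕ
𝟙 b = if b then 1 else 0

sumFin≡sum : ∀ {m} (f : Fin m → ℕ) → sumFin f ≡ sum f
sumFin≡sum {zero}  f = refl
sumFin≡sum {suc m} f = cong (f zero +_) (sumFin≡sum (f ∘ suc))

lsum-map-allFin : ∀ {m} (f : Fin m → ℕ) → lsum (map f (allFin m)) ≡ sum f
lsum-map-allFin {m} f = trans (cong lsum (map-tabulate (λ i → i) f)) (lsum-tabulate f)
  where
  lsum-tabulate : ∀ {m} (g : Fin m → ℕ) → lsum (tabulate g) ≡ sum g
  lsum-tabulate {zero}  g = refl
  lsum-tabulate {suc m} g = cong (g zero +_) (lsum-tabulate (g ∘ suc))

sum-mono-≤ : ∀ {m} {f g : Fin m → ℕ} → (∀ i → f i ≤ g i) → sum f ≤ sum g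
sum-mono-≤ {zero}  f≤g = z≤n
sum-mono-≤ {suc m} f≤g = +-mono-≤ (f≤g zero) (sum-mono-≤ (f≤g ∘ suc))

∑-const : ∀ m c → ∑[ i < m ] c ≡ m * c
∑-const zero    c = refl
∑-const (suc m) c = cong (c +_) (∑-const m c)

≤-sum : ∀ {m} (f : Fin m → ℕ) i → f i ≤ sum f
≤-sum f zero    = m≤m+n _ _
≤-sum f (suc i) = ≤-trans (≤-sum (f ∘ suc) i) (m≤n+m _ _)

∑-injective-≤ : ∀ {m N} {s : Fin m → Fin N} → Injective _≡_ _≡_ s →
                (g : Fin N → ℕ) → ∑[ j < m ] g (s j) ≤ ∑[ σ < N ] g σ
∑-injective-≤ {zero}                  s-inj g = z≤n
∑-injective-≤ {suc m} {zero}  {s}     s-inj g with s zero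
... | ()
∑-injective-≤ {suc m} {suc N} {s}     s-inj g = begin
  g (s zero) + ∑[ j < m ] g (s (suc j))
    ≡⟨ cong (g (s zero) +_) (sum-cong-≗ λ j → cong g (sym (punchIn-punchOut (s₀≢ j)))) ⟩
  g (s zero) + ∑[ j < m ] removeAt g (s zero) (s′ j)
    ≤⟨ +-monoʳ-≤ _ (∑-injective-≤ s′-inj (removeAt g (s zero))) ⟩
  g (s zero) + sum (removeAt g (s zero))
    ≡⟨ sum-remove g ⟨
  sum g
    ∎
  where
  open ≤-Reasoning
  s₀≢ : ∀ j → s zero ≢ s (suc j)
  s₀≢ j = Finₚ.0≢1+n ∘ s-inj
  s′ : Fin m → Fin N
  s′ j = punchOut (s₀≢ j)
  s′-inj : Injective _≡_ _≡_ s′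
  s′-inj {i} {j} e = Finₚ.suc-injective (s-inj (punchOut-injective (s₀≢ i) (s₀≢ j) e))

∑-indicator : ∀ {N} (a : Fin N) → ∑[ σ < N ] 𝟙 (does (a ≟F σ)) ≡ 1
∑-indicator {suc N} zero    = cong suc (sum-replicate-zero N)
∑-indicator {suc N} (suc a) = ∑-indicator a

module _ {p} {P : Pred ℕ p} (P? : Decidable P) where

  IsLeast : ℕ → Set p
  IsLeast a = P a × (∀ r → r < a → ¬ P r)

  search : ∀ b → (Σ ℕ λ a → a < b × IsLeast a) ⊎ (∀ r → r < b → ¬ P r)
  search zero = inj₂ λ _ ()
  search (suc b) with search b
  ... | inj₁ (a , a<b , isLeast) = inj₁ (a , m<n⇒m<1+n a<b , isLeast)
  ... | inj₂ none with P? b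
  ...   | yes pb  = inj₁ (b , ≤-refl , pb , none)
  ...   | no  ¬pb = inj₂ λ r r<1+b → [ none r , (λ { refl → ¬pb }) ]′ (m<1+n⇒m<n∨m≡n r<1+b)

  least : ∀ b → P b → Σ ℕ λ a → a ≤ b × IsLeast a
  least b pb with search (suc b)
  ... | inj₁ (a , a<1+b , isLeast) = a , m<1+n⇒m≤n a<1+b , isLeast
  ... | inj₂ none                  = contradiction pb (none b ≤-refl)

  greatest : P 0 → ∀ j → Σ ℕ λ k → P k × (∀ k′ → k′ ≤ j → P k′ → k′ ≤ k)
  greatest p₀ zero = 0 , p₀ , λ { k′ z≤n _ → z≤n }
  greatest p₀ (suc j) with P? (suc j) | greatest p₀ j
  ... | yes pj | _                 = suc j , pj , λ _ k′≤1+j _ → k′≤1+j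
  ... | no ¬pj | k , pk , maximal  = k , pk , λ k′ k′≤1+j pk′ →
    [ (λ k′<1+j → maximal k′ (m<1+n⇒m≤n k′<1+j) pk′) , (λ { refl → contradiction pk′ ¬pj }) ]′
      (m≤n⇒m<n∨m≡n k′≤1+j)

probeCx-≤ : ∀ {N} (f : ℕ → Maybe (Fin N)) {s p} → f p ≡ just s →
            Σ ℕ λ k → ProbeCx f s k × k ≤ suc p
probeCx-≤ f {s} fp with least (λ j → ≡-dec _≟F_ (f j) (just s)) _ fp
... | m , m≤p , fm , earlier-miss = suc m , (m , refl , fm , earlier-miss) , s≤s m≤p

hitWithin⇒hit : ∀ {N} (f : ℕ → Maybe (Fin N)) s i →
                hitWithin f s i ≡ true → Σ ℕ λ p → p < i × f p ≡ just s
hitWithin⇒hit f s (suc i) hw with hitWithin f s i in hw-i | f i in fi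
... | true  | _      = let p , p<i , fp = hitWithin⇒hit f s i hw-i in p , m<n⇒m<1+n p<i , fp
... | false | just t with t ≟F s
...   | yes refl = i , ≤-refl , fi
hitWithin⇒hit f s (suc i) () | false | just t  | no _
hitWithin⇒hit f s (suc i) () | false | nothing

hit⇒hitWithin : ∀ {N} (f : ℕ → Maybe (Fin N)) s {i p} → p < i → f p ≡ just s →
                hitWithin f s i ≡ true
hit⇒hitWithin f s {suc i} {p} p<1+i fp with m<1+n⇒m<n∨m≡n p<1+i
... | inj₁ p<i  rewrite hit⇒hitWithin f s p<i fp = refl
... | inj₂ refl rewrite fp with s ≟F s
...   | yes _  = ∨-zeroʳ (hitWithin f s p)
...   | no s≢s = contradiction refl s≢s

countHits≡∑ : ∀ {U N} (h : ProbeFn U N) s i →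
              countHits h s i ≡ ∑[ x < U ] 𝟙 (hitWithin (h x) s i)
countHits≡∑ h s i = lsum-map-allFin (λ x → 𝟙 (hitWithin (h x) s i))

countHits-zero : ∀ {U N} (h : ProbeFn U N) s → countHits h s 0 ≡ 0
countHits-zero {U} h s = trans (countHits≡∑ h s 0) (sum-replicate-zero U)

countHits-mono : ∀ {U N} (h₁ h₂ : ProbeFn U N) {s i j} →
                 (∀ x → hitWithin (h₁ x) s i ≡ true → hitWithin (h₂ x) s j ≡ true) →
                 countHits h₁ s i ≤ countHits h₂ s j
countHits-mono h₁ h₂ {s} {i} {j} hit₁⇒hit₂ = begin
  countHits h₁ s i                     ≡⟨ countHits≡∑ h₁ s i ⟩
  ∑[ x < _ ] 𝟙 (hitWithin (h₁ x) s i)  ≤⟨ sum-mono-≤ (λ x → indicator-mono (hit₁⇒hit₂ x)) ⟩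
  ∑[ x < _ ] 𝟙 (hitWithin (h₂ x) s j)  ≡⟨ countHits≡∑ h₂ s j ⟨
  countHits h₂ s j                     ∎
  where
  open ≤-Reasoning
  indicator-mono : ∀ {b₁ b₂} → (b₁ ≡ true → b₂ ≡ true) → 𝟙 b₁ ≤ 𝟙 b₂
  indicator-mono {false} _  = z≤n
  indicator-mono {true}  b₂ rewrite b₂ refl = ≤-refl

∑-hitWithin-≤ : ∀ {N} (f : ℕ → Maybe (Fin N)) t →
                ∑[ s < N ] 𝟙 (hitWithin f s t) ≤ t
∑-hitWithin-≤ {N} f zero    = ≤-reflexive (sum-replicate-zero N)
∑-hitWithin-≤ {N} f (suc t) = begin
  ∑[ s < N ] 𝟙 (hitWithin f s t ∨ isHit (f t) s)
    ≤⟨ sum-mono-≤ (λ s → indicator-∨ (hitWithin f s t)) ⟩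
  ∑[ s < N ] (𝟙 (hitWithin f s t) + 𝟙 (isHit (f t) s))
    ≡⟨ ∑-distrib-+ (λ s → 𝟙 (hitWithin f s t)) (λ s → 𝟙 (isHit (f t) s)) ⟩
  ∑[ s < N ] 𝟙 (hitWithin f s t) + ∑[ s < N ] 𝟙 (isHit (f t) s)
    ≤⟨ +-mono-≤ (∑-hitWithin-≤ f t) (one-slot-per-probe (f t)) ⟩
  t + 1
    ≡⟨ +-comm t 1 ⟩
  suc t
    ∎
  where
  open ≤-Reasoning
  indicator-∨ : ∀ a {b} → 𝟙 (a ∨ b) ≤ 𝟙 a + 𝟙 b
  indicator-∨ true  = s≤s z≤n
  indicator-∨ false = ≤-refl
  one-slot-per-probe : ∀ m → ∑[ s < N ] 𝟙 (isHit m s) ≤ 1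
  one-slot-per-probe nothing  = ≤-trans (≤-reflexive (sum-replicate-zero N)) z≤n
  one-slot-per-probe (just a) = ≤-reflexive (∑-indicator a)

∑-countHits-≤ : ∀ {U N} (h : ProbeFn U N) t → ∑[ s < N ] countHits h s t ≤ U * t
∑-countHits-≤ {U} {N} h t = begin
  ∑[ s < N ] countHits h s t                     ≡⟨ sum-cong-≗ (λ s → countHits≡∑ h s t) ⟩
  ∑[ s < N ] ∑[ x < U ] 𝟙 (hitWithin (h x) s t)  ≡⟨ ∑-comm (λ s x → 𝟙 (hitWithin (h x) s t)) ⟩
  ∑[ x < U ] ∑[ s < N ] 𝟙 (hitWithin (h x) s t)  ≤⟨ sum-mono-≤ (λ x → ∑-hitWithin-≤ (h x) t) ⟩
  ∑[ x < U ] t                                   ≡⟨ ∑-const U t ⟩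
  U * t                                          ∎
  where open ≤-Reasoning

m<2^m : ∀ m → m < 2 ^ m
m<2^m zero    = s≤s z≤n
m<2^m (suc m) = ≤-trans (+-mono-≤ (m^n>0 2 m) (m<2^m m)) (+-monoʳ-≤ (2 ^ m) (m≤m+n _ 0))

2^a+o<2^b : ∀ {a b o} → o < 2 ^ a → a < b → 2 ^ a + o < 2 ^ b
2^a+o<2^b {a} {b} {o} o<2^a a<b = begin-strict
  2 ^ a + o      <⟨ +-monoʳ-< (2 ^ a) o<2^a ⟩
  2 ^ a + 2 ^ a  ≡⟨ cong (2 ^ a +_) (+-identityʳ (2 ^ a)) ⟨
  2 ^ suc a      ≤⟨ ^-monoʳ-≤ 2 a<b ⟩
  2 ^ b          ∎
  where open ≤-Reasoning

2^+-injective : ∀ a b {o o′} → o < 2 ^ a → o′ < 2 ^ b → 2 ^ a + o ≡ 2 ^ b + o′ → o ≡ o′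
2^+-injective a b {o} {o′} o<2^a o′<2^b eq with <-cmp a b
... | tri< a<b _ _ = contradiction (≤-trans (2^a+o<2^b o<2^a a<b) (m≤m+n _ o′)) (<-irrefl eq)
... | tri≈ _ refl _ = +-cancelˡ-≡ (2 ^ a) o o′ eq
... | tri> _ _ b<a = contradiction (≤-trans (2^a+o<2^b o′<2^b b<a) (m≤m+n _ o)) (<-irrefl (sym eq))

-- 1/((1+t)(2+t)) = 1/(1+t) − 1/(2+t): the tail of the sum from index d is at most m/(1+d).
∑-telescope-tail : ∀ {m} (S : ℕ → ℕ) → (∀ t → suc t * (2 + t) * S t ≤ m) →
                   ∀ B d → suc d * ∑[ i < B ] S (toℕ i + d) ≤ m
∑-telescope-tail {m} S bound zero    d = ≤-trans (≤-reflexive (*-zeroʳ (suc d))) z≤n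
∑-telescope-tail {m} S bound (suc B) d = *-cancelˡ-≤ (2 + d) (begin
  (2 + d) * (suc d * (S d + tail))                  ≡⟨ expand (S d) tail d ⟩
  suc d * (2 + d) * S d + suc d * ((2 + d) * tail)  ≤⟨ +-mono-≤ (bound d) (*-monoʳ-≤ (suc d) tail-bound) ⟩
  m + suc d * m                                     ∎)
  where
  open ≤-Reasoning
  tail : ℕ
  tail = ∑[ i < B ] S (suc (toℕ i + d))
  tail-bound : (2 + d) * tail ≤ m
  tail-bound = subst (λ x → (2 + d) * x ≤ m)
    (sum-cong-≗ {B} (λ i → cong S (+-suc (toℕ i) d))) (∑-telescope-tail S bound B (suc d))
  expand : ∀ x y d → (2 + d) * (suc d * (x + y)) ≡ suc d * (2 + d) * x + suc d * ((2 + d) * y)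
  expand = solve-∀

∑-telescope : ∀ {m} (S : ℕ → ℕ) → (∀ t → suc t * (2 + t) * S t ≤ m) →
              ∀ B → ∑[ i < B ] S (toℕ i) ≤ m
∑-telescope S bound B = subst (_≤ _)
  (trans (+-identityʳ _) (sum-cong-≗ {B} (λ i → cong S (+-identityʳ (toℕ i)))))
  (∑-telescope-tail S bound B 0)

-- Group the selected terms by k: within one value of k the slot sums give
-- k(1+k) ∑ₛ W s k ≤ 2n, and these bounds telescope.
∑-injective-weighted-≤ :
  ∀ {m N U n} .{{_ : NonZero U}} (c W : Fin N → ℕ → ℕ) →
  (∀ k → ∑[ s < N ] c s k ≤ U * k) →
  (∀ s k → W s k * (k ^ 3 * U) ≤ n * c s k) →
  {slot : Fin m → Fin N} → Injective _≡_ _≡_ slot →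
  (k : Fin m → ℕ) → (∀ j → 1 ≤ k j) →
  ∑[ j < m ] W (slot j) (k j) ≤ 2 * n
∑-injective-weighted-≤ {m} {N} {U} {n} c W c-total W-weight {slot} slot-inj k 1≤k = begin
  ∑[ j < m ] W (slot j) (k j)                    ≤⟨ sum-mono-≤ (λ j → W≤V (slot j) (1≤k j) (≤-sum k j)) ⟩
  ∑[ j < m ] V (slot j)                          ≤⟨ ∑-injective-≤ slot-inj V ⟩
  ∑[ s < N ] ∑[ t < B ] W s (suc (toℕ t))        ≡⟨ ∑-comm {N} {B} (λ s t → W s (suc (toℕ t))) ⟩
  ∑[ t < B ] ∑[ s < N ] W s (suc (toℕ t))        ≤⟨ ∑-telescope (λ t → ∑[ s < N ] W s (suc t)) level-bound B ⟩
  2 * n                                          ∎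
  where
  open ≤-Reasoning
  B : ℕ
  B = sum k
  V : Fin N → ℕ
  V s = ∑[ t < B ] W s (suc (toℕ t))
  W≤V : ∀ s {k} → 1 ≤ k → k ≤ B → W s k ≤ V s
  W≤V s {suc o} _ o<B = subst (λ x → W s (suc x) ≤ V s) (toℕ-fromℕ< o<B) (≤-sum _ (fromℕ< o<B))
  level-sum : ∀ k → (∑[ s < N ] W s k) * (k ^ 3 * U) ≤ n * (U * k)
  level-sum k = begin
    (∑[ s < N ] W s k) * (k ^ 3 * U)       ≡⟨ *-distribʳ-sum (k ^ 3 * U) (λ s → W s k) ⟩
    ∑[ s < N ] (W s k * (k ^ 3 * U))       ≤⟨ sum-mono-≤ (λ s → W-weight s k) ⟩
    ∑[ s < N ] (n * c s k)                 ≡⟨ *-distribˡ-sum n (λ s → c s k) ⟨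
    n * ∑[ s < N ] c s k                   ≤⟨ *-monoʳ-≤ n (c-total k) ⟩
    n * (U * k)                            ∎
  level-bound : ∀ t → suc t * (2 + t) * ∑[ s < N ] W s (suc t) ≤ 2 * n
  level-bound t = *-cancelʳ-≤ _ _ (suc t * U) {{m*n≢0 (suc t) U}} (begin
    suc t * (2 + t) * S * (suc t * U)        ≤⟨ *-monoˡ-≤ _ (*-monoˡ-≤ S (*-monoʳ-≤ (suc t) 2+t≤2[1+t])) ⟩
    suc t * (2 * suc t) * S * (suc t * U)    ≡⟨ regroup S (suc t) U ⟩
    2 * (S * (suc t ^ 3 * U))                ≤⟨ *-monoʳ-≤ 2 (level-sum (suc t)) ⟩
    2 * (n * (U * suc t))                    ≡⟨ regroup′ n (suc t) U ⟩
    2 * n * (suc t * U)                      ∎)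
    where
    S : ℕ
    S = ∑[ s < N ] W s (suc t)
    2+t≤2[1+t] : 2 + t ≤ 2 * suc t
    2+t≤2[1+t] = ≤-trans (+-monoʳ-≤ 2 (m≤n*m t 2)) (≤-reflexive (sym (*-suc 2 t)))
    regroup : ∀ S k U → k * (2 * k) * S * (k * U) ≡ 2 * (S * (k * (k * (k * 1)) * U))
    regroup = solve-∀
    regroup′ : ∀ n k U → 2 * (n * (U * k)) ≡ 2 * n * (k * U)
    regroup′ = solve-∀

module Level (n U : ℕ) .{{_ : NonZero U}} where

  Fits : ℕ → ℕ → ℕ → Set
  Fits k c a = k ≤ 2 ^ a × n * c ≤ (2 ^ a) ^ 10 * U

  fits? : ∀ k c → Decidable (Fits k c)
  fits? k c a = (k ≤? 2 ^ a) ×-dec (n * c ≤? (2 ^ a) ^ 10 * U)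

  fits-large : ∀ k c → Fits k c (k + n * c)
  fits-large k c = <⇒≤ (≤-trans (s≤s (m≤m+n k (n * c))) 2^a-large) , (begin
    n * c              ≤⟨ m≤n+m (n * c) k ⟩
    k + n * c          ≤⟨ <⇒≤ 2^a-large ⟩
    2 ^ a              ≡⟨ *-identityʳ (2 ^ a) ⟨
    (2 ^ a) ^ 1        ≤⟨ ^-monoʳ-≤ (2 ^ a) ⦃ m^n≢0 2 a ⦄ {1} {10} (s≤s z≤n) ⟩
    (2 ^ a) ^ 10       ≤⟨ m≤m*n _ U ⟩
    (2 ^ a) ^ 10 * U   ∎)
    where
    open ≤-Reasoning
    a : ℕ
    a = k + n * c
    2^a-large : k + n * c < 2 ^ a
    2^a-large = m<2^m a

  opaque
    level : ℕ → ℕ → ℕ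
    level k c = proj₁ (least (fits? k c) (k + n * c) (fits-large k c))

    level-fits : ∀ k c → Fits k c (level k c)
    level-fits k c = proj₁ (proj₂ (proj₂ (least (fits? k c) (k + n * c) (fits-large k c))))

    level-minimal : ∀ k c r → r < level k c → ¬ Fits k c r
    level-minimal k c = proj₂ (proj₂ (proj₂ (least (fits? k c) (k + n * c) (fits-large k c))))

  -- Nonzero only when k ≤ 2^(a−1): a minimal level a was then forced by the count
  -- condition of Fits, which is what excess-weight exploits.
  excess : ℕ → ℕ → ℕ
  excess k zero    = 0
  excess k (suc r) with k ≤? 2 ^ r
  ... | yes _ = 2 ^ r
  ... | no  _ = 0

  2^≤excess : ∀ {k} a → 1 ≤ k → 2 ^ a ≤ 2 * k + 2 * excess k a
  2^≤excess {k} zero 1≤k = ≤-trans 1≤k (≤-trans (m≤m+n k (k + 0)) (m≤m+n _ 0))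
  2^≤excess {k} (suc r) 1≤k with k ≤? 2 ^ r
  ... | yes _   = m≤n+m (2 * 2 ^ r) (2 * k)
  ... | no  k≰  = ≤-trans (*-monoʳ-≤ 2 (<⇒≤ (≰⇒> k≰))) (m≤m+n (2 * k) 0)

  excess-weight : ∀ k c {a} → (∀ r → r < a → ¬ Fits k c r) → excess k a * (k ^ 3 * U) ≤ n * c
  excess-weight k c {zero}  _     = z≤n
  excess-weight k c {suc r} below with k ≤? 2 ^ r
  ... | no  _     = z≤n
  ... | yes k≤2^r = <⇒≤ (begin-strict
    2 ^ r * (k ^ 3 * U)             ≤⟨ *-monoʳ-≤ (2 ^ r) (*-monoˡ-≤ U (^-monoˡ-≤ 3 k≤2^r)) ⟩
    2 ^ r * ((2 ^ r) ^ 3 * U)       ≤⟨ *-monoʳ-≤ (2 ^ r) (*-monoˡ-≤ U (^-monoʳ-≤ (2 ^ r) ⦃ m^n≢0 2 r ⦄ {3} {9} 3≤9)) ⟩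
    2 ^ r * ((2 ^ r) ^ 9 * U)       ≡⟨ *-assoc (2 ^ r) _ U ⟨
    (2 ^ r) ^ 10 * U                <⟨ ≰⇒> (λ fits-c → below r ≤-refl (k≤2^r , fits-c)) ⟩
    n * c                           ∎)
    where
    open ≤-Reasoning
    3≤9 : 3 ≤ 9
    3≤9 = s≤s (s≤s (s≤s z≤n))

module Relocation {U N : ℕ} (n : ℕ) .{{_ : NonZero U}} (h : ProbeFn U N) where
  open Level n U

  level-at : Fin N → ℕ → ℕ
  level-at s o = level (suc o) (countHits h s (suc o))

  -- As o < 2^a, position s o lies in the block [2^a, 2^(a+1)) and determines o.
  position : Fin N → ℕ → ℕ
  position s o = 2 ^ level-at s o + o

  o<2^level-at : ∀ s o → o < 2 ^ level-at s o
  o<2^level-at s o = proj₁ (level-fits (suc o) (countHits h s (suc o)))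

  relocate : Fin U → ℕ → Maybe ℕ
  relocate x o = Maybe.map (λ s → position s o) (h x o)

  relocate-injective : ∀ {x o o′ p} → relocate x o ≡ just p → relocate x o′ ≡ just p → o ≡ o′
  relocate-injective {x} {o} {o′} r r′ with h x o | h x o′
  ... | just s  | just s′ = 2^+-injective (level-at s o) (level-at s′ o′)
    (o<2^level-at s o) (o<2^level-at s′ o′) (just-injective (trans r (sym r′)))
  relocate-injective () _ | nothing | _
  relocate-injective _ () | just _  | nothing

  relocate-hit : ∀ {x o s} → h x o ≡ just s → relocate x o ≡ just (position s o)
  relocate-hit {o = o} = cong (Maybe.map (λ s → position s o))

  relocates-to? : ∀ x p → Decidable (λ o → relocate x o ≡ just p)
  relocates-to? x p o = ≡-dec _≟_ (relocate x o) (just p)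

  h′ : ProbeFn U N
  h′ x p with search (relocates-to? x p) (suc p)
  ... | inj₁ (o , _) = h x o
  ... | inj₂ _       = nothing

  h′-relocates : ∀ {x o s} → h x o ≡ just s → h′ x (position s o) ≡ just s
  h′-relocates {x} {o} {s} hx with search (relocates-to? x (position s o)) (suc (position s o))
  ... | inj₁ (o′ , _ , r′ , _) = trans (cong (h x) (relocate-injective r′ (relocate-hit hx))) hx
  ... | inj₂ none              = contradiction (relocate-hit hx) (none o (s≤s (m≤n+m o _)))

  h′-origin : ∀ {x p s} → h′ x p ≡ just s → Σ ℕ λ o → h x o ≡ just s × position s o ≡ p
  h′-origin {x} {p} {s} h′x with search (relocates-to? x p) (suc p)
  ... | inj₁ (o , _ , r , _) = o , h′x , just-injective (trans (sym (relocate-hit h′x)) r)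

  nearlyUniform : NearlyUniform 1 n h′
  nearlyUniform i _ s with greatest (λ k → n * countHits h s k ≤? i ^ 10 * U) no-hits i
    where
    no-hits : n * countHits h s 0 ≤ i ^ 10 * U
    no-hits = ≤-trans (≤-reflexive (trans (cong (n *_) (countHits-zero h s)) (*-zeroʳ n))) z≤n
  ... | k* , k*-fits , k*-maximal = begin
    n * countHits h′ s i    ≤⟨ *-monoʳ-≤ n (countHits-mono h′ h {s} {i} {k*} early-in-h) ⟩
    n * countHits h s k*    ≤⟨ k*-fits ⟩
    i ^ 10 * U              ≡⟨ cong (_* U) (*-identityˡ (i ^ 10)) ⟨
    1 * i ^ 10 * U          ∎
    where
    open ≤-Reasoning
    early-in-h : ∀ x → hitWithin (h′ x) s i ≡ true → hitWithin (h x) s k* ≡ true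
    early-in-h x hw with hitWithin⇒hit (h′ x) s i hw
    ... | p , p<i , h′p with h′-origin h′p
    ...   | o , hx , position≡p = hit⇒hitWithin (h x) s (k*-maximal (suc o) 1+o≤i fits) hx
      where
      position≤i : position s o ≤ i
      position≤i = <⇒≤ (subst (_< i) (sym position≡p) p<i)
      1+o≤i : suc o ≤ i
      1+o≤i = ≤-trans (+-monoˡ-≤ o (m^n>0 2 (level-at s o))) position≤i
      fits : n * countHits h s (suc o) ≤ i ^ 10 * U
      fits = ≤-trans (proj₂ (level-fits (suc o) (countHits h s (suc o))))
                     (*-monoˡ-≤ U (^-monoˡ-≤ 10 (≤-trans (m≤m+n _ o) position≤i)))

  slot-excess : Fin N → ℕ → ℕ
  slot-excess s k = excess k (level k (countHits h s k))

  relocated-probeCx : ∀ {x s k} → ProbeCx (h x) s k →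
                      Σ ℕ λ k′ → ProbeCx (h′ x) s k′ × k′ ≤ 3 * k + 2 * slot-excess s k
  relocated-probeCx {x} {s} (m , refl , hx , _) with probeCx-≤ (h′ x) (h′-relocates hx)
  ... | k′ , cx′ , k′≤ = k′ , cx′ , (begin
    k′                                      ≤⟨ k′≤ ⟩
    suc (2 ^ level-at s m + m)              ≡⟨ +-suc _ m ⟨
    2 ^ level-at s m + suc m                ≤⟨ +-monoˡ-≤ (suc m) (2^≤excess {suc m} (level-at s m) (s≤s z≤n)) ⟩
    2 * suc m + 2 * E + suc m               ≡⟨ regroup (suc m) E ⟩
    3 * suc m + 2 * E                       ∎)
    where
    open ≤-Reasoning
    E : ℕ
    E = slot-excess s (suc m)
    regroup : ∀ k E → 2 * k + 2 * E + k ≡ 3 * k + 2 * E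
    regroup = solve-∀

  relocation-cost : ∀ {m} (key : Fin m → Fin U) {slot : Fin m → Fin N} → Injective _≡_ _≡_ slot →
    (cs : Fin m → ℕ) → (∀ j → ProbeCx (h (key j)) (slot j) (cs j)) →
    Σ (Fin m → ℕ) λ cs′ →
      (∀ j → ProbeCx (h′ (key j)) (slot j) (cs′ j)) × sumFin cs′ ≤ 4 * (sumFin cs + n)
  relocation-cost {m} key {slot} slot-inj cs cx = cs′ , (λ j → proj₁ (proj₂ (relocated j))) , (begin
    sumFin cs′                                  ≡⟨ sumFin≡sum cs′ ⟩
    ∑[ j < m ] cs′ j                            ≤⟨ sum-mono-≤ (λ j → proj₂ (proj₂ (relocated j))) ⟩
    ∑[ j < m ] (3 * cs j + 2 * E j)             ≡⟨ ∑-distrib-+ (λ j → 3 * cs j) (λ j → 2 * E j) ⟩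
    ∑[ j < m ] (3 * cs j) + ∑[ j < m ] (2 * E j) ≡⟨ cong₂ _+_ (*-distribˡ-sum 3 cs) (*-distribˡ-sum 2 E) ⟨
    3 * sum cs + 2 * sum E                      ≤⟨ +-mono-≤ (*-monoˡ-≤ (sum cs) (n≤1+n 3)) (*-monoʳ-≤ 2 excess-total) ⟩
    4 * sum cs + 2 * (2 * n)                    ≡⟨ regroup (sum cs) n ⟩
    4 * (sum cs + n)                            ≡⟨ cong (λ c → 4 * (c + n)) (sumFin≡sum cs) ⟨
    4 * (sumFin cs + n)                         ∎)
    where
    open ≤-Reasoning
    E : Fin m → ℕ
    E j = slot-excess (slot j) (cs j)
    relocated : ∀ j → Σ ℕ λ k′ → ProbeCx (h′ (key j)) (slot j) k′ × k′ ≤ 3 * cs j + 2 * E j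
    relocated j = relocated-probeCx (cx j)
    cs′ : Fin m → ℕ
    cs′ j = proj₁ (relocated j)
    excess-total : sum E ≤ 2 * n
    excess-total = ∑-injective-weighted-≤ {n = n} (countHits h) slot-excess (∑-countHits-≤ h)
      (λ s k → excess-weight k (countHits h s k) (level-minimal k (countHits h s k)))
      slot-inj cs (λ j → 1≤ (cx j))
      where
      1≤ : ∀ {f s k} → ProbeCx {N} f s k → 1 ≤ k
      1≤ (_ , refl , _) = s≤s z≤n
    regroup : ∀ c n → 4 * c + 2 * (2 * n) ≡ 4 * (c + n)
    regroup = solve-∀

lemma21 : Σ ℕ λ C → Σ ℕ λ D →
    (U N n : ℕ) → 0 < U → n ≤ N → (h : ProbeFn U N) →
    Σ (ProbeFn U N) λ h' →
    NearlyUniform C n h' ×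
    ((key : Fin n → Fin U) (slot : Fin n → Fin N) →
    Injective _≡_ _≡_ key → Injective _≡_ _≡_ slot →
    (cs : Fin n → ℕ) → (∀ j → ProbeCx (h (key j)) (slot j) (cs j)) →
    Σ (Fin n → ℕ) λ cs' →
    (∀ j → ProbeCx (h' (key j)) (slot j) (cs' j)) ×
    (sumFin cs' ≤ D * (sumFin cs + n)))
lemma21 = 1 , 4 , λ U N n 0<U _ h →
  let open Relocation n ⦃ >-nonZero 0<U ⦄ h in
  h′ , nearlyUniform , λ key _ _ slot-inj → relocation-cost key slot-inj
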